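{- Let $(A,B)$ be a suitable pair of $k$-tuples, with compound sequence $G(A,B)=(g_0,\dots,g_k)$, and fix an integer $j$ with $0\le j\le k$. Let \[U_{j,0}=\Big\{\sum_{i=0}^k n_ig_i : n_j=0,\ 0\le n_i<b_{i+1}\text{ for }0\le i<j,\ 0\le n_i<a_i\text{ for }j<i\le k\Big\}.\] Then for any function $f$ defined on the non-negative integers, \[\sum_{n\in \mathit{NR}(A,B)}\big[f(n+g_j)-f(n)\big]=\sum_{n\in U_{j,0}}f(n)-\sum_{n=0}^{g_j-1}f(n).\]
   Context: Let $\mathbb{N}$ be the positive integers and $\mathbb{N}_0$ the non-negative integers. For $k\in\mathbb{N}_0$, a pair $A=(a_1,\dots,a_k)$, $B=(b_1,\dots,b_k)\in\mathbb{N}^k$ is called suitable if $\gcd(a_i,b_j)=1$ for all $i\ge j$. Its compound sequence $G(A,B)=(g_0,\dots,g_k)$ is defined by $g_0=\prod_{i=1}^k a_i$ and $g_i=g_{i-1}b_i/a_i$, i.e. $g_i=b_1\cdots b_ia_{i+1}\cdots a_k$. $R(A,B)$ denotes the set of non-negative integer linear combinations of $g_0,\dots,g_k$, and $\mathit{NR}(A,B)=\mathbb{N}_0\setminus R(A,B)$ (a finite set). -}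

module Defs where

open import Level using (Level)
open import Data.Nat using (ℕ; zero; suc; _+_; _*_; _∸_; _<_; _≤_; _<ᵇ_; _<?_)
open import Data.Nat.GCD using (gcd)
open import Data.Fin using (Fin; toℕ; fromℕ<)
open import Data.List using (List; map; allFin; foldr)
open import Data.Nat.ListAction using (sum; product)
open import Data.List.Relation.Unary.Unique.Propositional using (Unique)
open import Data.List.Membership.Propositional using (_∈_)
open import Data.Bool using (if_then_else_)
open import Data.Product using (Σ; _×_; ∃)
open import Relation.Binary.PropositionalEquality using (_≡_)
open import Relation.Nullary using (¬_; yes; no)
open import Algebra.Bundles using (AbelianGroup)

-- A k-tuple of positive integers (a₁,…,aₖ) is represented as A : Fin k → ℕ,
-- with A at Fin-index t standing for a_{t+1}.
Positive : ∀ {k} → (Fin k → ℕ) → Set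
Positive A = ∀ t → 1 ≤ A t

-- Suitable pair: gcd(a_i, b_j) = 1 for all i ≥ j (1-based i,j ↔ 0-based s,t).
Suitable : ∀ {k} → (Fin k → ℕ) → (Fin k → ℕ) → Set
Suitable A B = ∀ s t → toℕ t ≤ toℕ s → gcd (A s) (B t) ≡ 1

-- compound sequence: g_i = b₁⋯b_i · a_{i+1}⋯a_k  for i = 0,…,k
g : ∀ {k} → (Fin k → ℕ) → (Fin k → ℕ) → Fin (suc k) → ℕ
g {k} A B i = product (map (λ t → if toℕ t <ᵇ toℕ i then B t else A t) (allFin k))

lincomb : ∀ {k} → (Fin k → ℕ) → (Fin k → ℕ) → (Fin (suc k) → ℕ) → ℕ
lincomb {k} A B c = sum (map (λ i → c i * g A B i) (allFin (suc k)))

R : ∀ {k} → (Fin k → ℕ) → (Fin k → ℕ) → ℕ → Set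
R {k} A B n = ∃ λ (c : Fin (suc k) → ℕ) → n ≡ lincomb A B c

NR : ∀ {k} → (Fin k → ℕ) → (Fin k → ℕ) → ℕ → Set
NR A B n = ¬ R A B n

-- 0-based lookup of a k-tuple by a natural number (junk value 0 out of range)
at : ∀ {k} → (Fin k → ℕ) → ℕ → ℕ
at {k} v n with n <? k
... | yes p = v (fromℕ< p)
... | no _  = 0

-- 1-based accessors: aᵢ = A₁ A i, bᵢ = A₁ B i (for 1 ≤ i ≤ k)
A₁ : ∀ {k} → (Fin k → ℕ) → ℕ → ℕ
A₁ v i = at v (i ∸ 1)

U0 : ∀ {k} → (Fin k → ℕ) → (Fin k → ℕ) → Fin (suc k) → ℕ → Set
U0 {k} A B j n = ∃ λ (c : Fin (suc k) → ℕ) →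
    c j ≡ 0
  × (∀ i → toℕ i < toℕ j → c i < A₁ B (suc (toℕ i)))
  × (∀ i → toℕ j < toℕ i → c i < A₁ A (toℕ i))
  × n ≡ lincomb A B c

Enumerates : List ℕ → (ℕ → Set) → Set
Enumerates xs P = Unique xs × (∀ n → (n ∈ xs → P n) × (P n → n ∈ xs))

module GroupSum {c ℓ : Level} (G : AbelianGroup c ℓ) where
  open AbelianGroup G
  gsum : List Carrier → Carrier
  gsum = foldr _∙_ ε

  _−_ : Carrier → Carrier → Carrier
  x − y = x ∙ (y ⁻¹)

module Submission where

-- The proof separates a combinatorial identity from a number-theoretic fact.
-- 1. Telescoping (apery-sum).  If S ⊆ ℕ is closed under adding d and U is its Apéry
--    set {n ∈ S : n − d ∉ S}, then the complement N of S satisfies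
--    N ⊔ U = (N + d) ⊔ [0, d); summing f over both sides and cancelling gives the
--    identity.  This holds for every d and every such S.
-- 2. U_{j,0} is the Apéry set of R(A,B) with respect to g_j (compound-apery).
--    Every representation Σ cᵢ gᵢ can be normalised to one with cᵢ < b_{i+1} for
--    i < j and cᵢ < aᵢ for i > j, by carrying excess towards index j along
--    aᵢ gᵢ = bᵢ g_{i−1} (normalise); and by suitability the j-th coefficient of a
--    normal representation is determined by its value (normal-unique), peeling off
--    the outermost digit with a coprimality argument (digit-unique).
--    This part works with tuples indexed by ℕ, which makes induction on k direct.
-- 3. The Fin-indexed notions of the statement are translated into the ℕ-indexed ones
--    (module FromFin), and theorem3p3 is apery-sum applied to compound-apery.

open import Defs
open import Level using (Level)
open import Data.Nat
open import Data.Nat.Properties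
open import Data.Nat.DivMod using (_/_; _%_; m≡m%n+[m/n]*n; m%n<n)
open import Data.Nat.Divisibility using (_∣_; ∣-trans; ∣1⇒≡1; ∣⇒≤; ∣m+n∣m⇒∣n; m∣m*n)
open import Data.Nat.Coprimality using (Coprime; coprime-divisor; gcd≡1⇒coprime) renaming (sym to coprime-sym)
open import Data.Nat.ListAction using (sum; product)
open import Data.Nat.Tactic.RingSolver using (solve-∀)
open import Data.Fin using (Fin; zero; suc; toℕ; fromℕ<)
open import Data.Fin.Properties using (toℕ<n; toℕ-fromℕ<; fromℕ<-toℕ)
open import Data.List using (List; []; _∷_; _++_; map; upTo; applyUpTo; allFin; tabulate)
open import Data.List.Properties using (map-++; map-∘; map-tabulate)
open import Data.List.Membership.DecPropositional _≟_ using (_∈_; _∈?_)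
open import Data.List.Membership.Propositional.Properties
  using (∈-map⁺; ∈-map⁻; ∈-upTo⁺; ∈-upTo⁻; ∈-++⁺ˡ; ∈-++⁺ʳ; ∈-++⁻)
open import Data.List.Membership.Propositional.Properties.WithK using (unique∧set⇒bag)
open import Data.List.Relation.Binary.BagAndSetEquality using (∼bag⇒↭)
open import Data.List.Relation.Binary.Disjoint.Propositional using (Disjoint)
open import Data.List.Relation.Binary.Permutation.Propositional using (_↭_; ↭⇒↭ₛ′)
import Data.List.Relation.Binary.Permutation.Propositional.Properties as Perm
open import Data.List.Relation.Binary.Permutation.Setoid.Properties using (foldr-commMonoid)
open import Data.List.Relation.Unary.Unique.Propositional using (Unique)
import Data.List.Relation.Unary.Unique.Propositional.Properties as Unique
open import Data.Bool using (true; false; if_then_else_; T)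
open import Data.Product using (Σ; _×_; _,_; proj₁; proj₂)
import Data.Product as Product
open import Data.Sum using (inj₁; inj₂)
open import Data.Empty using (⊥-elim)
open import Function using (_∘_; id)
open import Function.Bundles using (mk⇔)
open import Relation.Nullary using (¬_; yes; no)
open import Relation.Binary.PropositionalEquality
  using (_≡_; _≢_; refl; sym; trans; cong; cong₂; subst; subst₂; module ≡-Reasoning)
open import Algebra.Bundles using (AbelianGroup)
import Algebra.Properties.AbelianGroup as AbelianGroupProperties
import Algebra.Properties.CommutativeSemigroup as CommutativeSemigroupProperties
import Relation.Binary.Reasoning.Setoid as SetoidReasoning

record IsApery (S U : ℕ → Set) (d : ℕ) : Set where
  field
    closed   : ∀ {n} → S n → S (n + d)
    sound    : ∀ {n} → U n → S n
    gap      : ∀ {m} → U (m + d) → ¬ S m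
    complete : ∀ {n} → S n → (∀ {m} → n ≡ m + d → ¬ S m) → U n

module Telescoping {c ℓ : Level} (G : AbelianGroup c ℓ) where

  open AbelianGroup G hiding (refl; trans) renaming (sym to ≈-sym)
  open GroupSum G
  open AbelianGroupProperties G using (xyx⁻¹≈y; ⁻¹-∙-comm)
  open CommutativeSemigroupProperties commutativeSemigroup using (interchange)
  open SetoidReasoning setoid

  gsum-++ : (xs ys : List Carrier) → gsum (xs ++ ys) ≈ gsum xs ∙ gsum ys
  gsum-++ []       ys = ≈-sym (identityˡ (gsum ys))
  gsum-++ (x ∷ xs) ys = begin
    x ∙ gsum (xs ++ ys)         ≈⟨ ∙-congˡ (gsum-++ xs ys) ⟩
    x ∙ (gsum xs ∙ gsum ys)     ≈⟨ assoc x (gsum xs) (gsum ys) ⟨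
    (x ∙ gsum xs) ∙ gsum ys     ∎

  gsum-− : {X : Set} (h k : X → Carrier) (xs : List X) →
           gsum (map (λ x → h x − k x) xs) ≈ gsum (map h xs) − gsum (map k xs)
  gsum-− h k []       = ≈-sym (inverseʳ ε)
  gsum-− h k (x ∷ xs) = begin
    (h x − k x) ∙ gsum (map (λ x → h x − k x) xs)   ≈⟨ ∙-congˡ (gsum-− h k xs) ⟩
    (h x ∙ k x ⁻¹) ∙ (Sh ∙ Sk ⁻¹)                   ≈⟨ interchange (h x) (k x ⁻¹) Sh (Sk ⁻¹) ⟩
    (h x ∙ Sh) ∙ (k x ⁻¹ ∙ Sk ⁻¹)                   ≈⟨ ∙-congˡ (⁻¹-∙-comm (k x) Sk) ⟩
    (h x ∙ Sh) ∙ (k x ∙ Sk) ⁻¹                      ∎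
    where
    Sh = gsum (map h xs)
    Sk = gsum (map k xs)

  -- Sums over two duplicate-free lists with the same elements agree:
  -- such lists are permutations of each other.
  gsum-set : (f : ℕ → Carrier) (xs ys : List ℕ) → Unique xs → Unique ys →
             (∀ {n} → n ∈ xs → n ∈ ys) → (∀ {n} → n ∈ ys → n ∈ xs) →
             gsum (map f xs) ≈ gsum (map f ys)
  gsum-set f xs ys xs! ys! xs⊆ys ys⊆xs =
    foldr-commMonoid setoid isCommutativeMonoid
      (↭⇒↭ₛ′ isEquivalence (Perm.map⁺ f xs↭ys))
    where
    xs↭ys : xs ↭ ys
    xs↭ys = ∼bag⇒↭ (unique∧set⇒bag xs! ys! (mk⇔ xs⊆ys ys⊆xs))

  exchange : ∀ {x y z w} → x ∙ y ≈ z ∙ w → z − x ≈ y − w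
  exchange {x} {y} {z} {w} eq = begin
    z ∙ x ⁻¹                   ≈⟨ ∙-congʳ (identityʳ z) ⟨
    (z ∙ ε) ∙ x ⁻¹             ≈⟨ ∙-congʳ (∙-congˡ (inverseʳ w)) ⟨
    (z ∙ (w ∙ w ⁻¹)) ∙ x ⁻¹    ≈⟨ ∙-congʳ (assoc z w (w ⁻¹)) ⟨
    ((z ∙ w) ∙ w ⁻¹) ∙ x ⁻¹    ≈⟨ ∙-congʳ (∙-congʳ (≈-sym eq)) ⟩
    ((x ∙ y) ∙ w ⁻¹) ∙ x ⁻¹    ≈⟨ ∙-congʳ (assoc x y (w ⁻¹)) ⟩
    (x ∙ (y ∙ w ⁻¹)) ∙ x ⁻¹    ≈⟨ xyx⁻¹≈y x (y ∙ w ⁻¹) ⟩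
    y ∙ w ⁻¹                   ∎

  telescope : (f : ℕ → Carrier) (d : ℕ) (xs ys : List ℕ) →
    Unique xs → Unique ys → Disjoint xs ys →
    (∀ {n} → n ∈ xs ++ ys → n ∈ map (_+ d) xs ++ upTo d) →
    (∀ {n} → n ∈ map (_+ d) xs ++ upTo d → n ∈ xs ++ ys) →
    gsum (map (λ n → f (n + d) − f n) xs) ≈ gsum (map f ys) − gsum (map f (upTo d))
  telescope f d xs ys xs! ys! xs#ys ⊆shifted shifted⊆ = begin
    gsum (map (λ n → f (n + d) − f n) xs)          ≈⟨ gsum-− (λ n → f (n + d)) f xs ⟩
    gsum (map (λ n → f (n + d)) xs) − gsum (map f xs)  ≈⟨ exchange balance ⟩
    gsum (map f ys) − gsum (map f (upTo d))        ∎
    where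
    shifted = map (_+ d) xs

    shifted! : Unique (shifted ++ upTo d)
    shifted! = Unique.++⁺ (Unique.map⁺ {f = _+ d} (+-cancelʳ-≡ d _ _) xs!) (Unique.upTo⁺ d) below
      where
      below : Disjoint shifted (upTo d)
      below (v∈shifted , v∈upTo) with ∈-map⁻ (_+ d) v∈shifted
      ... | m , _ , refl = <⇒≱ (∈-upTo⁻ v∈upTo) (m≤n+m d m)

    balance : gsum (map f xs) ∙ gsum (map f ys) ≈ gsum (map (λ n → f (n + d)) xs) ∙ gsum (map f (upTo d))
    balance = begin
      gsum (map f xs) ∙ gsum (map f ys)            ≈⟨ gsum-++ (map f xs) (map f ys) ⟨
      gsum (map f xs ++ map f ys)                  ≡⟨ cong gsum (map-++ f xs ys) ⟨
      gsum (map f (xs ++ ys))                      ≈⟨ gsum-set f _ _ (Unique.++⁺ xs! ys! xs#ys) shifted!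
                                                                 ⊆shifted shifted⊆ ⟩
      gsum (map f (shifted ++ upTo d))             ≡⟨ cong gsum (map-++ f shifted (upTo d)) ⟩
      gsum (map f shifted ++ map f (upTo d))       ≈⟨ gsum-++ (map f shifted) (map f (upTo d)) ⟩
      gsum (map f shifted) ∙ gsum (map f (upTo d)) ≡⟨ cong (λ l → gsum l ∙ gsum (map f (upTo d))) (map-∘ xs) ⟨
      gsum (map (λ n → f (n + d)) xs) ∙ gsum (map f (upTo d)) ∎

  -- Sum over the complement of S of the differences f (n + d) − f n, where U is
  -- the Apéry set of S: the lists nrs ++ us and (nrs + d) ++ [0, d) have the same elements.
  apery-sum : ∀ {S U d} → IsApery S U d → (f : ℕ → Carrier) (nrs us : List ℕ) →
    Enumerates nrs (λ n → ¬ S n) → Enumerates us U →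
    gsum (map (λ n → f (n + d) − f n) nrs) ≈ gsum (map f us) − gsum (map f (upTo d))
  apery-sum {S} {U} {d} apery f nrs us (nrs! , nrs-enum) (us! , us-enum) =
    telescope f d nrs us nrs! us! disjoint into from
    where
    open IsApery apery

    disjoint : Disjoint nrs us
    disjoint (n∈nrs , n∈us) = proj₁ (nrs-enum _) n∈nrs (sound (proj₁ (us-enum _) n∈us))

    small-or-shifted : ∀ n → (∀ {m} → n ≡ m + d → ¬ S m) → n ∈ map (_+ d) nrs ++ upTo d
    small-or-shifted n no-pred with n <? d
    ... | yes n<d = ∈-++⁺ʳ _ (∈-upTo⁺ n<d)
    ... | no  n≮d = ∈-++⁺ˡ (subst (_∈ map (_+ d) nrs) n-d+d≡n (∈-map⁺ (_+ d) n-d∈nrs))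
      where
      n-d+d≡n : n ∸ d + d ≡ n
      n-d+d≡n = m∸n+n≡m (≮⇒≥ n≮d)
      n-d∈nrs : n ∸ d ∈ nrs
      n-d∈nrs = proj₂ (nrs-enum _) (no-pred (sym n-d+d≡n))

    into : ∀ {n} → n ∈ nrs ++ us → n ∈ map (_+ d) nrs ++ upTo d
    into {n} n∈ with ∈-++⁻ nrs n∈
    ... | inj₁ n∈nrs = small-or-shifted n (λ n≡m+d Sm →
                          proj₁ (nrs-enum n) n∈nrs (subst S (sym n≡m+d) (closed Sm)))
    ... | inj₂ n∈us  = small-or-shifted n (λ n≡m+d → gap (subst U n≡m+d (proj₁ (us-enum n) n∈us)))

    no-predecessor : ∀ {n} → n ∈ map (_+ d) nrs ++ upTo d → ∀ {m} → n ≡ m + d → ¬ S m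
    no-predecessor {n} n∈ {m} n≡m+d with ∈-++⁻ (map (_+ d) nrs) n∈
    ... | inj₁ n∈shifted with ∈-map⁻ (_+ d) n∈shifted
    ...   | m′ , m′∈nrs , n≡m′+d =
      subst (λ x → ¬ S x) (+-cancelʳ-≡ d m′ m (trans (sym n≡m′+d) n≡m+d)) (proj₁ (nrs-enum m′) m′∈nrs)
    no-predecessor {n} n∈ {m} n≡m+d | inj₂ n∈upTo =
      ⊥-elim (<⇒≱ (∈-upTo⁻ n∈upTo) (subst (d ≤_) (sym n≡m+d) (m≤n+m d m)))

    from : ∀ {n} → n ∈ map (_+ d) nrs ++ upTo d → n ∈ nrs ++ us
    from {n} n∈ with n ∈? nrs
    ... | yes n∈nrs = ∈-++⁺ˡ n∈nrs
    ... | no  n∉nrs with n ∈? us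
    ...   | yes n∈us = ∈-++⁺ʳ nrs n∈us
    ...   | no  n∉us = ⊥-elim (n∉nrs (proj₂ (nrs-enum n) (λ Sn →
                          n∉us (proj₂ (us-enum n) (complete Sn (no-predecessor n∈))))))

sumUpTo : (ℕ → ℕ) → ℕ → ℕ
sumUpTo F n = sum (applyUpTo F n)

prodUpTo : (ℕ → ℕ) → ℕ → ℕ
prodUpTo F n = product (applyUpTo F n)

sumUpTo-cong : ∀ n (F H : ℕ → ℕ) → (∀ {i} → i < n → F i ≡ H i) → sumUpTo F n ≡ sumUpTo H n
sumUpTo-cong zero    F H F≗H = refl
sumUpTo-cong (suc n) F H F≗H = cong₂ _+_ (F≗H z<s) (sumUpTo-cong n (F ∘ suc) (H ∘ suc) (F≗H ∘ s<s))

prodUpTo-cong : ∀ n (F H : ℕ → ℕ) → (∀ {i} → i < n → F i ≡ H i) → prodUpTo F n ≡ prodUpTo H n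
prodUpTo-cong zero    F H F≗H = refl
prodUpTo-cong (suc n) F H F≗H = cong₂ _*_ (F≗H z<s) (prodUpTo-cong n (F ∘ suc) (H ∘ suc) (F≗H ∘ s<s))

sumUpTo-snoc : ∀ n (F : ℕ → ℕ) → sumUpTo F (suc n) ≡ sumUpTo F n + F n
sumUpTo-snoc zero    F = +-comm (F 0) 0
sumUpTo-snoc (suc n) F = trans (cong (F 0 +_) (sumUpTo-snoc n (F ∘ suc))) (sym (+-assoc (F 0) _ _))

prodUpTo-snoc : ∀ n (F : ℕ → ℕ) → prodUpTo F (suc n) ≡ prodUpTo F n * F n
prodUpTo-snoc zero    F = trans (*-identityʳ (F 0)) (sym (*-identityˡ (F 0)))
prodUpTo-snoc (suc n) F = trans (cong (F 0 *_) (prodUpTo-snoc n (F ∘ suc))) (sym (*-assoc (F 0) _ _))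

sumUpTo-scale : ∀ n x (F : ℕ → ℕ) → sumUpTo (λ i → x * F i) n ≡ x * sumUpTo F n
sumUpTo-scale zero    x F = sym (*-zeroʳ x)
sumUpTo-scale (suc n) x F =
  trans (cong (x * F 0 +_) (sumUpTo-scale n x (F ∘ suc))) (sym (*-distribˡ-+ x (F 0) _))

update : (ℕ → ℕ) → ℕ → ℕ → ℕ → ℕ
update c j x i = if i ≡ᵇ j then x else c i

update-same : ∀ (c : ℕ → ℕ) j x → update c j x j ≡ x
update-same c j x with j ≡ᵇ j in eq
... | true  = refl
... | false = ⊥-elim (subst T eq (≡⇒≡ᵇ j j refl))

update-other : ∀ (c : ℕ → ℕ) j x {i} → i ≢ j → update c j x i ≡ c i
update-other c j x {i} i≢j with i ≡ᵇ j in eq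
... | true  = ⊥-elim (i≢j (≡ᵇ⇒≡ i j (subst T (sym eq) _)))
... | false = refl

sumUpTo-update : ∀ n (c h : ℕ → ℕ) j x → j < n →
  sumUpTo (λ i → update c j x i * h i) n + c j * h j ≡ sumUpTo (λ i → c i * h i) n + x * h j
sumUpTo-update (suc n) c h zero x _ =
  rearrange (x * h 0) (sumUpTo (λ i → c (suc i) * h (suc i)) n) (c 0 * h 0)
  where
  rearrange : ∀ p q r → p + q + r ≡ r + q + p
  rearrange = solve-∀
sumUpTo-update (suc n) c h (suc j) x (s<s j<n) = begin
  c 0 * h 0 + S′ + c (suc j) * h (suc j)    ≡⟨ +-assoc (c 0 * h 0) S′ _ ⟩
  c 0 * h 0 + (S′ + c (suc j) * h (suc j))  ≡⟨ cong (c 0 * h 0 +_) (sumUpTo-update n (c ∘ suc) (h ∘ suc) j x j<n) ⟩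
  c 0 * h 0 + (S + x * h (suc j))           ≡⟨ +-assoc (c 0 * h 0) S _ ⟨
  c 0 * h 0 + S + x * h (suc j)             ∎
  where
  open ≡-Reasoning
  S′ = sumUpTo (λ i → update c (suc j) x (suc i) * h (suc i)) n
  S  = sumUpTo (λ i → c (suc i) * h (suc i)) n

select-below : ∀ {t i} (x y : ℕ) → t < i → (if t <ᵇ i then x else y) ≡ x
select-below {t} {i} x y t<i with t <ᵇ i in eq
... | true  = refl
... | false = ⊥-elim (subst T eq (<⇒<ᵇ t<i))

select-above : ∀ {t i} (x y : ℕ) → i ≤ t → (if t <ᵇ i then x else y) ≡ y
select-above {t} {i} x y i≤t with t <ᵇ i in eq
... | true  = ⊥-elim (<⇒≱ (<ᵇ⇒< t i (subst T (sym eq) _)) i≤t)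
... | false = refl

-- Compound sequence of the n-tuples (a₀,…,a_{n−1}), (b₀,…,b_{n−1}), indexed from 0:
-- term a b n i = b₀⋯b_{i−1}·a_i⋯a_{n−1}, for 0 ≤ i ≤ n.
term : (a b : ℕ → ℕ) (n i : ℕ) → ℕ
term a b n i = prodUpTo (λ t → if t <ᵇ i then b t else a t) n

comb : (a b : ℕ → ℕ) (n : ℕ) (c : ℕ → ℕ) → ℕ
comb a b n c = sumUpTo (λ i → c i * term a b n i) (suc n)

module _ (a b : ℕ → ℕ) where

  comb-cong : ∀ n {c d : ℕ → ℕ} → (∀ {i} → i ≤ n → c i ≡ d i) → comb a b n c ≡ comb a b n d
  comb-cong n {c} {d} c≗d = sumUpTo-cong (suc n) (λ i → c i * term a b n i) (λ i → d i * term a b n i)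
    (λ {i} i<1+n → cong (_* term a b n i) (c≗d (s≤s⁻¹ i<1+n)))

  term-snoc : ∀ n i → i ≤ n → term a b (suc n) i ≡ term a b n i * a n
  term-snoc n i i≤n = trans (prodUpTo-snoc n (λ t → if t <ᵇ i then b t else a t))
    (cong (term a b n i *_) (select-above (b n) (a n) i≤n))

  term-snoc-top : ∀ n → term a b (suc n) (suc n) ≡ term a b n n * b n
  term-snoc-top n = trans (prodUpTo-snoc n (λ t → if t <ᵇ suc n then b t else a t))
    (cong₂ _*_ (prodUpTo-cong n _ (λ t → if t <ᵇ n then b t else a t)
                 (λ {t} t<n → trans (select-below (b t) (a t) (m<n⇒m<1+n t<n))
                                    (sym (select-below (b t) (a t) t<n))))
               (select-below (b n) (a n) (n<1+n n)))

  comb-snoc : ∀ n (c : ℕ → ℕ) →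
    comb a b (suc n) c ≡ a n * comb a b n c + c (suc n) * term a b (suc n) (suc n)
  comb-snoc n c = trans (sumUpTo-snoc (suc n) (λ i → c i * term a b (suc n) i))
    (cong (_+ c (suc n) * term a b (suc n) (suc n)) lower)
    where
    lower : sumUpTo (λ i → c i * term a b (suc n) i) (suc n) ≡ a n * comb a b n c
    lower = trans (sumUpTo-cong (suc n) _ (λ i → a n * (c i * term a b n i)) (λ {i} i<1+n →
                    trans (cong (c i *_) (term-snoc n i (s≤s⁻¹ i<1+n))) (rearrange (c i) (term a b n i) (a n))))
                  (sumUpTo-scale (suc n) (a n) (λ i → c i * term a b n i))
      where
      rearrange : ∀ x y z → x * (y * z) ≡ z * (x * y)
      rearrange = solve-∀

  comb-cons : ∀ n (c : ℕ → ℕ) →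
    comb a b (suc n) c ≡ c 0 * term a b (suc n) 0 + b 0 * comb (a ∘ suc) (b ∘ suc) n (c ∘ suc)
  comb-cons n c = cong (c 0 * term a b (suc n) 0 +_)
    (trans (sumUpTo-cong (suc n) _ (λ i → b 0 * F i) (λ {i} _ → rearrange (c (suc i)) (b 0) (term a′ b′ n i)))
           (sumUpTo-scale (suc n) (b 0) F))
    where
    a′ = a ∘ suc
    b′ = b ∘ suc
    F = λ i → c (suc i) * term a′ b′ n i
    rearrange : ∀ x y z → x * (y * z) ≡ y * (x * z)
    rearrange = solve-∀

  comb-update : ∀ n (c : ℕ → ℕ) {j} x → j ≤ n →
    comb a b n (update c j x) + c j * term a b n j ≡ comb a b n c + x * term a b n j
  comb-update n c {j} x j≤n = sumUpTo-update (suc n) c (term a b n) j x (s≤s j≤n)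

  comb-bump : ∀ n (c : ℕ → ℕ) {j} t → j ≤ n →
    comb a b n (update c j (c j + t)) ≡ comb a b n c + t * term a b n j
  comb-bump n c {j} t j≤n = +-cancelʳ-≡ (c j * G) _ _
    (trans (comb-update n c (c j + t) j≤n) (rearrange (comb a b n c) (c j) t G))
    where
    G = term a b n j
    rearrange : ∀ L x y G → L + (x + y) * G ≡ L + y * G + x * G
    rearrange = solve-∀

  comb-clear : ∀ n (c : ℕ → ℕ) {j} → j ≤ n →
    comb a b n c ≡ comb a b n (update c j 0) + c j * term a b n j
  comb-clear n c j≤n = sym (trans (comb-update n c 0 j≤n) (+-identityʳ _))

coprime-* : ∀ {a x y} → Coprime a x → Coprime a y → Coprime a (x * y)
coprime-* cx cy (d∣a , d∣xy) =
  cy (d∣a , coprime-divisor (λ (e∣d , e∣x) → cx (∣-trans e∣d d∣a , e∣x)) d∣xy)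

coprime-prodUpTo : ∀ a (F : ℕ → ℕ) n → (∀ {t} → t < n → Coprime a (F t)) → Coprime a (prodUpTo F n)
coprime-prodUpTo a F zero    cop (_ , d∣1) = ∣1⇒≡1 d∣1
coprime-prodUpTo a F (suc n) cop = coprime-* (cop z<s) (coprime-prodUpTo a (F ∘ suc) n (cop ∘ s<s))

multiple-below : ∀ {a e} → a ∣ e → e < a → e ≡ 0
multiple-below {e = zero}  _   _   = refl
multiple-below {e = suc e} a∣e e<a = ⊥-elim (<⇒≱ e<a (∣⇒≤ a∣e))

-- First the case c ≤ d, where
-- a·X = a·Y + (d − c)·P forces a ∣ (d − c), hence d − c = 0.
digit-unique-≤ : ∀ {a P X Y c d} → Coprime a P → d < a → c ≤ d →
                 a * X + c * P ≡ a * Y + d * P → c ≡ d × X ≡ Y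
digit-unique-≤ {a} {P} {X} {Y} {c} {d} cop d<a c≤d eq = c≡d , X≡Y
  where
  e = d ∸ c
  d≡c+e : d ≡ c + e
  d≡c+e = sym (m+[n∸m]≡n c≤d)
  aX≡aY+eP : a * X ≡ a * Y + e * P
  aX≡aY+eP = +-cancelʳ-≡ (c * P) _ _
    (trans eq (trans (cong (λ z → a * Y + z * P) d≡c+e) (rearrange (a * Y) c e P)))
    where
    rearrange : ∀ u c e P → u + (c + e) * P ≡ u + e * P + c * P
    rearrange = solve-∀
  a∣e : a ∣ e
  a∣e = coprime-divisor cop (subst (a ∣_) (*-comm e P)
          (∣m+n∣m⇒∣n (subst (a ∣_) aX≡aY+eP (m∣m*n X)) (m∣m*n Y)))
  e≡0 : e ≡ 0
  e≡0 = multiple-below a∣e (≤-<-trans (m∸n≤m d c) d<a)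
  c≡d : c ≡ d
  c≡d = sym (trans d≡c+e (trans (cong (c +_) e≡0) (+-identityʳ c)))
  X≡Y : X ≡ Y
  X≡Y = *-cancelˡ-≡ X Y a {{>-nonZero (≤-<-trans z≤n d<a)}}
          (trans aX≡aY+eP (trans (cong (λ z → a * Y + z * P) e≡0) (+-identityʳ (a * Y))))

digit-unique : ∀ {a P X Y c d} → Coprime a P → c < a → d < a →
               a * X + c * P ≡ a * Y + d * P → c ≡ d × X ≡ Y
digit-unique {c = c} {d = d} cop c<a d<a eq with ≤-total c d
... | inj₁ c≤d = digit-unique-≤ cop d<a c≤d eq
... | inj₂ d≤c = Product.map sym sym (digit-unique-≤ cop c<a d≤c (sym eq))

PositiveUpTo : (a b : ℕ → ℕ) → ℕ → Set
PositiveUpTo a b n = ∀ {t} → t < n → 0 < a t × 0 < b t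

SuitableUpTo : (a b : ℕ → ℕ) → ℕ → Set
SuitableUpTo a b n = ∀ {s t} → t ≤ s → s < n → Coprime (a s) (b t)

record Normal (a b : ℕ → ℕ) (n j : ℕ) (c : ℕ → ℕ) : Set where
  field
    below : ∀ {i} → i < j → c i < b i
    above : ∀ {i} → j < i → i ≤ n → c i < a (i ∸ 1)
open Normal

module _ {a b : ℕ → ℕ} {m : ℕ} where

  coprime-top : SuitableUpTo a b (suc m) → Coprime (a m) (term a b (suc m) (suc m))
  coprime-top suit = coprime-prodUpTo (a m) _ (suc m) (λ {t} t<1+m →
    subst (Coprime (a m)) (sym (select-below (b t) (a t) t<1+m)) (suit (s≤s⁻¹ t<1+m) (n<1+n m)))

  coprime-bottom : SuitableUpTo a b (suc m) → Coprime (b 0) (term a b (suc m) 0)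
  coprime-bottom suit = coprime-prodUpTo (b 0) a (suc m) (λ t<1+m → coprime-sym (suit z≤n t<1+m))

  peel-last : ∀ {c d} → SuitableUpTo a b (suc m) → c (suc m) < a m → d (suc m) < a m →
              comb a b (suc m) c ≡ comb a b (suc m) d → comb a b m c ≡ comb a b m d
  peel-last {c} {d} suit c<a d<a eq = proj₂ (digit-unique (coprime-top suit) c<a d<a
    (trans (sym (comb-snoc a b m c)) (trans eq (comb-snoc a b m d))))

  peel-first : ∀ {c d} → SuitableUpTo a b (suc m) → c 0 < b 0 → d 0 < b 0 →
               comb a b (suc m) c ≡ comb a b (suc m) d →
               comb (a ∘ suc) (b ∘ suc) m (c ∘ suc) ≡ comb (a ∘ suc) (b ∘ suc) m (d ∘ suc)
  peel-first {c} {d} suit c<b d<b eq = proj₂ (digit-unique (coprime-bottom suit) c<b d<b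
    (trans (+-comm _ (c 0 * term a b (suc m) 0))
      (trans (sym (comb-cons a b m c))
        (trans eq (trans (comb-cons a b m d) (+-comm (d 0 * term a b (suc m) 0) _))))))

  suitable-init : SuitableUpTo a b (suc m) → SuitableUpTo a b m
  suitable-init suit t≤s s<m = suit t≤s (m<n⇒m<1+n s<m)

  suitable-tail : SuitableUpTo a b (suc m) → SuitableUpTo (a ∘ suc) (b ∘ suc) m
  suitable-tail suit t≤s s<m = suit (s≤s t≤s) (s<s s<m)

  normal-init : ∀ {j c} → Normal a b (suc m) j c → Normal a b m j c
  normal-init nc = record { below = below nc ; above = λ j<i i≤m → above nc j<i (m≤n⇒m≤1+n i≤m) }

  normal-tail : ∀ {c} → Normal a b (suc m) (suc m) c → Normal (a ∘ suc) (b ∘ suc) m m (c ∘ suc)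
  normal-tail nc = record { below = below nc ∘ s<s ; above = λ m<i i≤m → ⊥-elim (<⇒≱ m<i i≤m) }

normal-unique : ∀ n {a b j c d} → j ≤ n → SuitableUpTo a b n →
                Normal a b n j c → Normal a b n j d → comb a b n c ≡ comb a b n d → c j ≡ d j
normal-unique zero {c = c} {d} z≤n _ _ _ eq = trans (sym (unit (c 0))) (trans eq (unit (d 0)))
  where
  unit : ∀ x → x * 1 + 0 ≡ x
  unit = solve-∀
normal-unique (suc m) {c = c} {d} j≤1+m suit nc nd eq with m≤n⇒m<n∨m≡n j≤1+m
... | inj₁ j<1+m = normal-unique m {c = c} {d} (s≤s⁻¹ j<1+m)
      (suitable-init suit) (normal-init nc) (normal-init nd)
      (peel-last {c = c} {d} suit (above nc j<1+m ≤-refl) (above nd j<1+m ≤-refl) eq)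
... | inj₂ refl = normal-unique m {c = c ∘ suc} {d ∘ suc} ≤-refl
      (suitable-tail suit) (normal-tail nc) (normal-tail nd)
      (peel-first {c = c} {d} suit (below nc z<s) (below nd z<s) eq)

cons : ℕ → (ℕ → ℕ) → ℕ → ℕ
cons r e zero    = r
cons r e (suc i) = e i

module _ {a b : ℕ → ℕ} {m : ℕ} where

  positive-init : PositiveUpTo a b (suc m) → PositiveUpTo a b m
  positive-init pos = pos ∘ m<n⇒m<1+n

  positive-tail : PositiveUpTo a b (suc m) → PositiveUpTo (a ∘ suc) (b ∘ suc) m
  positive-tail pos = pos ∘ s<s

  normal-snoc : ∀ {j d r} → j ≤ m → Normal a b m j d → r < a m → Normal a b (suc m) j (update d (suc m) r)
  normal-snoc {j} {d} {r} j≤m nd r<a = record { below = new-below ; above = new-above }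
    where
    new-below : ∀ {i} → i < j → update d (suc m) r i < b i
    new-below i<j = subst (_< b _) (sym (update-other d (suc m) r (<⇒≢ (m<n⇒m<1+n (<-≤-trans i<j j≤m)))))
                      (below nd i<j)
    new-above : ∀ {i} → j < i → i ≤ suc m → update d (suc m) r i < a (i ∸ 1)
    new-above {i} j<i i≤1+m with m≤n⇒m<n∨m≡n i≤1+m
    ... | inj₁ i<1+m = subst (_< a (i ∸ 1)) (sym (update-other d (suc m) r (<⇒≢ i<1+m)))
                         (above nd j<i (s≤s⁻¹ i<1+m))
    ... | inj₂ refl  = subst (_< a m) (sym (update-same d (suc m) r)) r<a

  normal-cons : ∀ {e r} → r < b 0 → Normal (a ∘ suc) (b ∘ suc) m m e → Normal a b (suc m) (suc m) (cons r e)
  normal-cons {e} {r} r<b ne = record { below = new-below ; above = λ m<i i≤m → ⊥-elim (<⇒≱ m<i i≤m) }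
    where
    new-below : ∀ {i} → i < suc m → cons r e i < b i
    new-below {zero}  _       = r<b
    new-below {suc i} i+1<1+m = below ne (s<s⁻¹ i+1<1+m)

  -- Carrying at the top: with c_{m+1} = r + q·a_m, the excess q·a_m·g_{m+1} equals
  -- a_m · (q·b_m)·g_m, so it can be moved into the m-th coefficient of the lower part.
  carry-last : ∀ c .{{_ : NonZero (a m)}} →
    comb a b (suc m) c ≡ a m * comb a b m (update c m (c m + c (suc m) / a m * b m))
                         + c (suc m) % a m * term a b (suc m) (suc m)
  carry-last c = begin
    comb a b (suc m) c                            ≡⟨ comb-snoc a b m c ⟩
    a m * L + c (suc m) * term a b (suc m) (suc m) ≡⟨ cong₂ (λ x y → a m * L + x * y)
                                                       (m≡m%n+[m/n]*n (c (suc m)) (a m)) (term-snoc-top a b m) ⟩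
    a m * L + (r + q * a m) * (G * b m)           ≡⟨ rearrange (a m) L r q (b m) G ⟩
    a m * (L + q * b m * G) + r * (G * b m)       ≡⟨ cong₂ (λ x y → a m * x + r * y)
                                                       (comb-bump a b m c (q * b m) ≤-refl) (term-snoc-top a b m) ⟨
    a m * comb a b m (update c m (c m + q * b m)) + r * term a b (suc m) (suc m) ∎
    where
    open ≡-Reasoning
    L = comb a b m c
    G = term a b m m
    q = c (suc m) / a m
    r = c (suc m) % a m
    rearrange : ∀ A L r q B G → A * L + (r + q * A) * (G * B) ≡ A * (L + q * B * G) + r * (G * B)
    rearrange = solve-∀

  comb-set-last : ∀ d r →
    comb a b (suc m) (update d (suc m) r) ≡ a m * comb a b m d + r * term a b (suc m) (suc m)
  comb-set-last d r = trans (comb-snoc a b m (update d (suc m) r))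
    (cong₂ (λ x y → a m * x + y * term a b (suc m) (suc m))
      (comb-cong a b m (λ i≤m → update-other d (suc m) r (<⇒≢ (s≤s i≤m))))
      (update-same d (suc m) r))

  -- Carrying at the bottom: with c₀ = r + q·b₀, the excess q·b₀·g₀ equals
  -- b₀ · (q·a₀)·g₀′ for the first term g₀′ of the shifted tuples.
  carry-first : ∀ c .{{_ : NonZero (b 0)}} →
    comb a b (suc m) c ≡ c 0 % b 0 * term a b (suc m) 0
      + b 0 * comb (a ∘ suc) (b ∘ suc) m (update (c ∘ suc) 0 (c 1 + c 0 / b 0 * a 0))
  carry-first c = begin
    comb a b (suc m) c                            ≡⟨ comb-cons a b m c ⟩
    c 0 * (a 0 * G) + b 0 * L                     ≡⟨ cong (λ x → x * (a 0 * G) + b 0 * L)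
                                                       (m≡m%n+[m/n]*n (c 0) (b 0)) ⟩
    (r + q * b 0) * (a 0 * G) + b 0 * L           ≡⟨ rearrange r q (b 0) (a 0) G L ⟩
    r * (a 0 * G) + b 0 * (L + q * a 0 * G)       ≡⟨ cong (λ x → r * (a 0 * G) + b 0 * x)
                                                       (comb-bump (a ∘ suc) (b ∘ suc) m (c ∘ suc) (q * a 0) z≤n) ⟨
    r * (a 0 * G) + b 0 * comb (a ∘ suc) (b ∘ suc) m (update (c ∘ suc) 0 (c 1 + q * a 0)) ∎
    where
    open ≡-Reasoning
    L = comb (a ∘ suc) (b ∘ suc) m (c ∘ suc)
    G = term (a ∘ suc) (b ∘ suc) m 0
    q = c 0 / b 0
    r = c 0 % b 0
    rearrange : ∀ r q B A G L → (r + q * B) * (A * G) + B * L ≡ r * (A * G) + B * (L + q * A * G)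
    rearrange = solve-∀

-- Existence of normal forms: every representation can be replaced by a normal one
-- with the same value, by carrying excess from the top down to index j and from
-- the bottom up to index j.
normalise : ∀ n {a b j} → j ≤ n → PositiveUpTo a b n → (c : ℕ → ℕ) →
            Σ (ℕ → ℕ) λ c′ → Normal a b n j c′ × comb a b n c ≡ comb a b n c′
normalise zero z≤n pos c = c , record { below = λ () ; above = λ 0<i i≤0 → ⊥-elim (<⇒≱ 0<i i≤0) } , refl
normalise (suc m) {a} {b} {j} j≤1+m pos c with m≤n⇒m<n∨m≡n j≤1+m
... | inj₁ j<1+m = update d (suc m) r , normal-snoc (s≤s⁻¹ j<1+m) nd (m%n<n (c (suc m)) (a m)) ,
      trans (carry-last {a} {b} {m} c)
        (trans (cong (λ x → a m * x + r * term a b (suc m) (suc m)) eq) (sym (comb-set-last {a} {b} {m} d r)))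
  where
  instance
    a≢0 : NonZero (a m)
    a≢0 = >-nonZero (proj₁ (pos (n<1+n m)))
  r = c (suc m) % a m
  lower = normalise m (s≤s⁻¹ j<1+m) (positive-init pos) (update c m (c m + c (suc m) / a m * b m))
  d = proj₁ lower
  nd = proj₁ (proj₂ lower)
  eq = proj₂ (proj₂ lower)
... | inj₂ refl = cons r e , normal-cons (m%n<n (c 0) (b 0)) ne ,
      trans (carry-first {a} {b} {m} c)
        (trans (cong (λ x → r * term a b (suc m) 0 + b 0 * x) eq) (sym (comb-cons a b m (cons r e))))
  where
  instance
    b≢0 : NonZero (b 0)
    b≢0 = >-nonZero (proj₂ (pos z<s))
  r = c 0 % b 0
  upper = normalise m ≤-refl (positive-tail pos) (update (c ∘ suc) 0 (c 1 + c 0 / b 0 * a 0))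
  e = proj₁ upper
  ne = proj₁ (proj₂ upper)
  eq = proj₂ (proj₂ upper)

Representable : (a b : ℕ → ℕ) (n x : ℕ) → Set
Representable a b n x = Σ (ℕ → ℕ) λ c → x ≡ comb a b n c

-- x has a normal representation relative to j whose j-th coefficient vanishes (the set U_{j,0}).
NormalWithout : (a b : ℕ → ℕ) (n j x : ℕ) → Set
NormalWithout a b n j x = Σ (ℕ → ℕ) λ c → c j ≡ 0 × Normal a b n j c × x ≡ comb a b n c

normal-update : ∀ {a b n j c} x → Normal a b n j c → Normal a b n j (update c j x)
normal-update {a} {b} {n} {j} {c} x nc = record
  { below = λ {i} i<j → subst (_< b i) (sym (update-other c j x (<⇒≢ i<j))) (below nc i<j)
  ; above = λ {i} j<i i≤n → subst (_< a (i ∸ 1)) (sym (update-other c j x (>⇒≢ j<i))) (above nc j<i i≤n)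
  }

-- Closure is clear; the gap property is
-- uniqueness of normal forms (a representation of n − g_j would give one of n with
-- j-th coefficient ≥ 1); completeness is existence of normal forms (a normal form with
-- j-th coefficient ≥ 1 would represent n − g_j).
compound-apery : ∀ n {a b j} → j ≤ n → PositiveUpTo a b n → SuitableUpTo a b n →
  IsApery (Representable a b n) (NormalWithout a b n j) (term a b n j)
compound-apery n {a} {b} {j} j≤n pos suit =
  record { closed = closed ; sound = sound ; gap = gap ; complete = complete }
  where
  G = term a b n j

  raise : ∀ c t → comb a b n (update c j (c j + t)) ≡ comb a b n c + t * G
  raise c t = comb-bump a b n c t j≤n

  closed : ∀ {x} → Representable a b n x → Representable a b n (x + G)
  closed {x} (c , x≡) = update c j (c j + 1) , (begin
    x + G                     ≡⟨ cong₂ _+_ x≡ (sym (*-identityˡ G)) ⟩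
    comb a b n c + 1 * G      ≡⟨ raise c 1 ⟨
    comb a b n (update c j (c j + 1)) ∎)
    where open ≡-Reasoning

  sound : ∀ {x} → NormalWithout a b n j x → Representable a b n x
  sound (c , _ , _ , x≡) = c , x≡

  gap : ∀ {m} → NormalWithout a b n j (m + G) → ¬ Representable a b n m
  gap {m} (c , cj≡0 , nc , m+G≡) (e , m≡) = 0≢1+n (begin
    0                           ≡⟨ cj≡0 ⟨
    c j                         ≡⟨ normal-unique n j≤n suit nc (normal-update (d j + 1) nd) same-value ⟩
    update d j (d j + 1) j      ≡⟨ update-same d j (d j + 1) ⟩
    d j + 1                     ≡⟨ +-comm (d j) 1 ⟩
    suc (d j)                   ∎)
    where
    open ≡-Reasoning
    normal = normalise n j≤n pos e
    d = proj₁ normal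
    nd = proj₁ (proj₂ normal)
    same-value : comb a b n c ≡ comb a b n (update d j (d j + 1))
    same-value = begin
      comb a b n c              ≡⟨ m+G≡ ⟨
      m + G                     ≡⟨ cong₂ _+_ (trans m≡ (proj₂ (proj₂ normal))) (sym (*-identityˡ G)) ⟩
      comb a b n d + 1 * G      ≡⟨ raise d 1 ⟨
      comb a b n (update d j (d j + 1)) ∎

  complete : ∀ {x} → Representable a b n x → (∀ {m} → x ≡ m + G → ¬ Representable a b n m) →
             NormalWithout a b n j x
  complete {x} (e , x≡) no-pred with normalise n j≤n pos e
  ... | d , nd , e≡d with d j in dj≡
  ...   | zero  = d , dj≡ , nd , trans x≡ e≡d
  ...   | suc t = ⊥-elim (no-pred x≡m+G (update d₀ j (d₀ j + t) , sym (raise d₀ t)))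
    where
    open ≡-Reasoning
    d₀ = update d j 0
    x≡m+G : x ≡ comb a b n d₀ + t * G + G
    x≡m+G = begin
      x                                ≡⟨ trans x≡ e≡d ⟩
      comb a b n d                     ≡⟨ comb-clear a b n d j≤n ⟩
      comb a b n d₀ + d j * G          ≡⟨ cong (λ y → comb a b n d₀ + y * G) dj≡ ⟩
      comb a b n d₀ + suc t * G        ≡⟨ rearrange (comb a b n d₀) t G ⟩
      comb a b n d₀ + t * G + G        ∎
      where
      rearrange : ∀ L t G → L + suc t * G ≡ L + t * G + G
      rearrange = solve-∀

IsApery-transport : ∀ {S S′ U U′ : ℕ → Set} {d} →
  (∀ {n} → S n → S′ n) → (∀ {n} → S′ n → S n) →
  (∀ {n} → U n → U′ n) → (∀ {n} → U′ n → U n) →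
  IsApery S U d → IsApery S′ U′ d
IsApery-transport S⇒S′ S′⇒S U⇒U′ U′⇒U apery = record
  { closed   = S⇒S′ ∘ closed ∘ S′⇒S
  ; sound    = S⇒S′ ∘ sound ∘ U′⇒U
  ; gap      = λ Um+d S′m → gap (U′⇒U Um+d) (S′⇒S S′m)
  ; complete = λ S′n no-pred → U⇒U′ (complete (S′⇒S S′n) (λ n≡m+d → no-pred n≡m+d ∘ S⇒S′))
  }
  where open IsApery apery

at-< : ∀ {k} (v : Fin k → ℕ) {t} (t<k : t < k) → at v t ≡ v (fromℕ< t<k)
at-< {k} v {t} t<k with t <? k
... | yes _   = refl
... | no  t≮k = ⊥-elim (t≮k t<k)

at-toℕ : ∀ {k} (v : Fin k → ℕ) (i : Fin k) → at v (toℕ i) ≡ v i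
at-toℕ v i = trans (at-< v (toℕ<n i)) (cong v (fromℕ<-toℕ i (toℕ<n i)))

tabulate≡applyUpTo : ∀ m (F : Fin m → ℕ) (H : ℕ → ℕ) → (∀ t → F t ≡ H (toℕ t)) →
                     tabulate F ≡ applyUpTo H m
tabulate≡applyUpTo zero    F H F≗H = refl
tabulate≡applyUpTo (suc m) F H F≗H =
  cong₂ _∷_ (F≗H zero) (tabulate≡applyUpTo m (F ∘ suc) (H ∘ suc) (F≗H ∘ suc))

map-allFin : ∀ m (F : Fin m → ℕ) (H : ℕ → ℕ) → (∀ t → F t ≡ H (toℕ t)) →
             map F (allFin m) ≡ applyUpTo H m
map-allFin m F H F≗H = trans (map-tabulate id F) (tabulate≡applyUpTo m F H F≗H)

module FromFin {k : ℕ} (A B : Fin k → ℕ) where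

  a b : ℕ → ℕ
  a = at A
  b = at B

  g≡term : ∀ i → g A B i ≡ term a b k (toℕ i)
  g≡term i = cong product (map-allFin k _ (λ t → if t <ᵇ toℕ i then b t else a t)
    (λ t → cong₂ (if toℕ t <ᵇ toℕ i then_else_) (sym (at-toℕ B t)) (sym (at-toℕ A t))))

  lincomb≡comb : ∀ c → lincomb A B c ≡ comb a b k (at c)
  lincomb≡comb c = cong sum (map-allFin (suc k) _ (λ i → at c i * term a b k i)
    (λ i → cong₂ _*_ (sym (at-toℕ c i)) (g≡term i)))

  lincomb-toℕ : ∀ e → lincomb A B (e ∘ toℕ) ≡ comb a b k e
  lincomb-toℕ e = trans (lincomb≡comb (e ∘ toℕ))
    (comb-cong a b k (λ i≤k → trans (at-< (e ∘ toℕ) (s≤s i≤k)) (cong e (toℕ-fromℕ< (s≤s i≤k)))))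

  R⇒Representable : ∀ {n} → R A B n → Representable a b k n
  R⇒Representable (c , n≡) = at c , trans n≡ (lincomb≡comb c)

  Representable⇒R : ∀ {n} → Representable a b k n → R A B n
  Representable⇒R (e , n≡) = e ∘ toℕ , trans n≡ (sym (lincomb-toℕ e))

  U0⇒NormalWithout : ∀ j {n} → U0 A B j n → NormalWithout a b k (toℕ j) n
  U0⇒NormalWithout j (c , cj≡0 , c-below , c-above , n≡) =
    at c , trans (at-toℕ c j) cj≡0 , record { below = new-below ; above = new-above } ,
    trans n≡ (lincomb≡comb c)
    where
    new-below : ∀ {i} → i < toℕ j → at c i < b i
    new-below {i} i<j = subst₂ _<_ (sym (at-< c i<1+k)) (cong b (toℕ-fromℕ< i<1+k))
      (c-below (fromℕ< i<1+k) (subst (_< toℕ j) (sym (toℕ-fromℕ< i<1+k)) i<j))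
      where
      i<1+k : i < suc k
      i<1+k = <-≤-trans i<j (<⇒≤ (toℕ<n j))
    new-above : ∀ {i} → toℕ j < i → i ≤ k → at c i < a (i ∸ 1)
    new-above {i} j<i i≤k =
      subst₂ _<_ (sym (at-< c (s≤s i≤k))) (cong (λ t → a (t ∸ 1)) (toℕ-fromℕ< (s≤s i≤k)))
      (c-above (fromℕ< (s≤s i≤k)) (subst (toℕ j <_) (sym (toℕ-fromℕ< (s≤s i≤k))) j<i))

  NormalWithout⇒U0 : ∀ j {n} → NormalWithout a b k (toℕ j) n → U0 A B j n
  NormalWithout⇒U0 j (e , ej≡0 , ne , n≡) =
    e ∘ toℕ , ej≡0 , (λ i → below ne) , (λ i j<i → above ne j<i (s≤s⁻¹ (toℕ<n i))) ,
    trans n≡ (sym (lincomb-toℕ e))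

  positive : Positive A → Positive B → PositiveUpTo a b k
  positive posA posB t<k =
    subst (0 <_) (sym (at-< A t<k)) (posA _) , subst (0 <_) (sym (at-< B t<k)) (posB _)

  suitable : Suitable A B → SuitableUpTo a b k
  suitable suit {s} {t} t≤s s<k = subst₂ Coprime (sym (at-< A s<k)) (sym (at-< B t<k))
    (gcd≡1⇒coprime (suit (fromℕ< s<k) (fromℕ< t<k)
      (subst₂ _≤_ (sym (toℕ-fromℕ< t<k)) (sym (toℕ-fromℕ< s<k)) t≤s)))
    where
    t<k : t < k
    t<k = ≤-<-trans t≤s s<k

  U0-apery : Positive A → Positive B → Suitable A B → ∀ j → IsApery (R A B) (U0 A B j) (g A B j)
  U0-apery posA posB suit j = subst (IsApery (R A B) (U0 A B j)) (sym (g≡term j))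
    (IsApery-transport Representable⇒R R⇒Representable (NormalWithout⇒U0 j) (U0⇒NormalWithout j)
      (compound-apery k (s≤s⁻¹ (toℕ<n j)) (positive posA posB) (suitable suit)))

theorem3p3 : ∀ {c ℓ : Level} (G : AbelianGroup c ℓ) (k : ℕ)
    (A B : Fin k → ℕ) → Positive A → Positive B → Suitable A B →
    (j : Fin (suc k)) (f : ℕ → AbelianGroup.Carrier G)
    (nrs us : List ℕ) → Enumerates nrs (NR A B) → Enumerates us (U0 A B j) →
    AbelianGroup._≈_ G
      (GroupSum.gsum G (map (λ n → GroupSum._−_ G (f (n + g A B j)) (f n)) nrs))
      (GroupSum._−_ G (GroupSum.gsum G (map f us)) (GroupSum.gsum G (map f (upTo (g A B j)))))
theorem3p3 G k A B posA posB suit j f nrs us nrs-enum us-enum =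
  Telescoping.apery-sum G (FromFin.U0-apery A B posA posB suit j) f nrs us nrs-enum us-enum
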